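{- A neural code $\mathcal C\subseteq 2^{[n]}$ is intersection-complete if and only if the assignment $\sigma\mapsto\mathrm{Tk}_{\mathcal C}(\sigma)$ defines a bijection between $\mathcal C$ and the set of nonempty trunks in $\mathcal C$.
   Context: A neural code is a set $\mathcal C\subseteq 2^{[n]}$ containing $\varnothing$. For $\sigma\subseteq[n]$, the trunk $\mathrm{Tk}_{\mathcal C}(\sigma)=\{\tau\in\mathcal C:\sigma\subseteq\tau\}$; the trunks in $\mathcal C$ are the sets of this form, for arbitrary $\sigma\subseteq[n]$. A code is intersection-complete if $\sigma\cap\tau\in\mathcal C$ for all $\sigma,\tau\in\mathcal C$. -}

module Defs where

open import Data.Nat using (ℕ)
open import Data.Bool using (Bool; true)
open import Data.Product using (Σ; ∃; _×_; proj₁; _,_)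
open import Data.Fin.Subset using (Subset; _⊆_; _∩_; ⊥)
open import Relation.Binary.PropositionalEquality using (_≡_)
open import Function.Bundles using (_⇔_)
open import Function.Definitions using (Bijective)

-- A neural code on [n] = Fin n: a set of subsets of [n], given by its
-- (decidable, as it is finite) characteristic function.
Code : ℕ → Set
Code n = Subset n → Bool

_∈C_ : ∀ {n} → Subset n → Code n → Set
σ ∈C C = C σ ≡ true

IsNeuralCode : ∀ {n} → Code n → Set
IsNeuralCode C = ⊥ ∈C C

Tk : ∀ {n} → Code n → Subset n → Subset n → Set
Tk C σ τ = (τ ∈C C) × (σ ⊆ τ)

_≈Tk[_]_ : ∀ {n} → Subset n → Code n → Subset n → Set
σ ≈Tk[ C ] ρ = ∀ τ → Tk C σ τ ⇔ Tk C ρ τ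

IntersectionComplete : ∀ {n} → Code n → Set
IntersectionComplete C = ∀ σ τ → σ ∈C C → τ ∈C C → (σ ∩ τ) ∈C C

Codeword : ∀ {n} → Code n → Set
Codeword {n} C = Σ (Subset n) (λ σ → σ ∈C C)

-- nonempty trunks in C, each represented by some σ ⊆ [n] generating it
-- (equality given by equality of the trunks as sets, see _≈Tk[_]_)
NonemptyTrunk : ∀ {n} → Code n → Set
NonemptyTrunk {n} C = Σ (Subset n) (λ σ → ∃ (λ τ → Tk C σ τ))

_≈CW_ : ∀ {n} {C : Code n} → Codeword C → Codeword C → Set
x ≈CW y = proj₁ x ≡ proj₁ y

_≈NT_ : ∀ {n} {C : Code n} → NonemptyTrunk C → NonemptyTrunk C → Set
_≈NT_ {C = C} x y = proj₁ x ≈Tk[ C ] proj₁ y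

tk : ∀ {n} (C : Code n) → Codeword C → NonemptyTrunk C
tk C (σ , σ∈C) = σ , σ , σ∈C , (λ x → x)

TkBijective : ∀ {n} → Code n → Set
TkBijective C = Bijective (_≈CW_ {C = C}) (_≈NT_ {C = C}) (tk C)

{-# OPTIONS --safe #-}
-- A trunk Tk(σ) is generated by a codeword c, i.e. Tk(c) = Tk(σ), exactly
-- when c is the least element of Tk(σ); as least elements are unique, the
-- map σ ↦ Tk(σ) is injective on every code. If C is intersection-complete,
-- every trunk is a finite family closed under ∩, so a nonempty one has a
-- least element and is generated by it. Conversely, for σ, τ ∈ C the
-- codeword generating Tk(σ ∩ τ) lies below σ and τ and above σ ∩ τ, so it
-- is σ ∩ τ.
module Submission where

open import Data.Nat using (ℕ)
open import Data.Bool using (true)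
open import Data.Bool.Properties using () renaming (_≟_ to _≟ᵇ_)
open import Data.Product using (∃; _×_; _,_; proj₁; proj₂)
open import Data.Fin.Subset using (Subset; _⊆_; _⊂_; _∩_)
open import Data.Fin.Subset.Properties
  using (_∈?_; _⊆?_; _⊂?_; ⊆-refl; ⊆-trans; ⊆-antisym; p∩q⊆p; p∩q⊆q; x∈p∩q⁺; anySubset?)
open import Data.Fin.Subset.Induction using (⊂-wellFounded)
open import Function.Base using (_∘_)
open import Function.Bundles using (_⇔_; mk⇔; Equivalence)
open import Function.Definitions using (Injective; Surjective)
open import Induction.WellFounded using (Acc; acc)
open import Level using (Level)
open import Relation.Binary.PropositionalEquality using (_≡_; refl; subst)
open import Relation.Nullary using (¬_; yes; no; contradiction)
open import Relation.Nullary.Decidable using (_×-dec_)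
open import Relation.Unary using (Pred; Decidable; Satisfiable)
open import Defs

private
  variable
    ℓ : Level
    n : ℕ
    μ σ : Subset n

⊆-∩⁺ : {p q r : Subset n} → p ⊆ q → p ⊆ r → p ⊆ q ∩ r
⊆-∩⁺ p⊆q p⊆r x∈p = x∈p∩q⁺ (p⊆q x∈p , p⊆r x∈p)

p∩q⊄p⇒p⊆q : {p q : Subset n} → ¬ (p ∩ q ⊂ p) → p ⊆ q
p∩q⊄p⇒p⊆q {p = p} {q} p∩q⊄p {x} x∈p with x ∈? q
... | yes x∈q = x∈q
... | no  x∉q = contradiction ((λ {_} → p∩q⊆p p q) , x , x∈p , x∉q ∘ p∩q⊆q p q) p∩q⊄p

∩-Closed : Pred (Subset n) ℓ → Set ℓ
∩-Closed P = ∀ {p q} → P p → P q → P (p ∩ q)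

Least : Pred (Subset n) ℓ → Pred (Subset n) ℓ
Least P μ = P μ × (∀ {ρ} → P ρ → μ ⊆ ρ)

least-unique : {P : Pred (Subset n) ℓ} {μ ν : Subset n} → Least P μ → Least P ν → μ ≡ ν
least-unique (Pμ , μ-least) (Pν , ν-least) = ⊆-antisym (μ-least Pν) (ν-least Pμ)

∩-closed⇒least : {P : Pred (Subset n) ℓ} →
                 Decidable P → ∩-Closed P → Satisfiable P → ∃ (Least P)
∩-closed⇒least {P = P} P? closed (τ , Pτ) = descend τ Pτ (⊂-wellFounded τ)
  where
  descend : ∀ τ → P τ → Acc _⊂_ τ → ∃ (Least P)
  descend τ Pτ (acc smaller) with anySubset? (λ ρ → P? ρ ×-dec (τ ∩ ρ ⊂? τ))
  ... | yes (ρ , Pρ , τ∩ρ⊂τ) = descend (τ ∩ ρ) (closed Pτ Pρ) (smaller τ∩ρ⊂τ)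
  ... | no  ¬shrinks = τ , Pτ , λ Pρ → p∩q⊄p⇒p⊆q (λ τ∩ρ⊂τ → ¬shrinks (_ , Pρ , τ∩ρ⊂τ))

module _ {C : Code n} where

  Tk? : ∀ σ → Decidable (Tk C σ)
  Tk? σ ρ = (C ρ ≟ᵇ true) ×-dec (σ ⊆? ρ)

  Tk-∩-closed : IntersectionComplete C → ∀ σ → ∩-Closed (Tk C σ)
  Tk-∩-closed ic σ (p∈C , σ⊆p) (q∈C , σ⊆q) = ic _ _ p∈C q∈C , ⊆-∩⁺ σ⊆p σ⊆q

  least-in-own-Tk : σ ∈C C → Least (Tk C σ) σ
  least-in-own-Tk σ∈C = (σ∈C , ⊆-refl) , proj₂

  least⇒≈Tk : Least (Tk C σ) μ → μ ≈Tk[ C ] σ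
  least⇒≈Tk {σ} {μ} ((_ , σ⊆μ) , μ-least) τ = mk⇔ Tkμ⇒Tkσ (λ Tkστ → proj₁ Tkστ , μ-least Tkστ)
    where
    Tkμ⇒Tkσ : Tk C μ τ → Tk C σ τ
    Tkμ⇒Tkσ (τ∈C , μ⊆τ) = τ∈C , ⊆-trans σ⊆μ μ⊆τ

  ≈Tk⇒least : μ ∈C C → μ ≈Tk[ C ] σ → Least (Tk C σ) μ
  ≈Tk⇒least {μ} μ∈C μ≈σ =
    Equivalence.to (μ≈σ μ) (μ∈C , ⊆-refl) ,
    λ {ρ} Tkσρ → proj₂ (Equivalence.from (μ≈σ ρ) Tkσρ)

  tk-injective : Injective (_≈CW_ {C = C}) (_≈NT_ {C = C}) (tk C)
  tk-injective {σ , σ∈C} {ρ , ρ∈C} σ≈ρ =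
    least-unique (≈Tk⇒least σ∈C σ≈ρ) (least-in-own-Tk ρ∈C)

  tk-surjective : IntersectionComplete C → Surjective (_≈CW_ {C = C}) (_≈NT_ {C = C}) (tk C)
  tk-surjective ic (σ , nonempty)
    with ∩-closed⇒least (Tk? σ) (Tk-∩-closed ic σ) nonempty
  ... | μ , least@((μ∈C , _) , _) = (μ , μ∈C) , λ { {_ , _} refl → least⇒≈Tk least }

  tk-bijective : IntersectionComplete C → TkBijective C
  tk-bijective ic = (λ {x y} → tk-injective {x} {y}) , tk-surjective ic

  surjective⇒intersectionComplete :
    Surjective (_≈CW_ {C = C}) (_≈NT_ {C = C}) (tk C) → IntersectionComplete C
  surjective⇒intersectionComplete surj σ τ σ∈C τ∈C
    with surj (σ ∩ τ , σ , σ∈C , p∩q⊆p σ τ)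
  ... | (c , c∈C) , c≈σ∩τ = subst (_∈C C) (⊆-antisym c⊆σ∩τ σ∩τ⊆c) c∈C
    where
    least : Least (Tk C (σ ∩ τ)) c
    least = ≈Tk⇒least c∈C (c≈σ∩τ {c , c∈C} refl)

    σ∩τ⊆c : σ ∩ τ ⊆ c
    σ∩τ⊆c = proj₂ (proj₁ least)

    c⊆σ∩τ : c ⊆ σ ∩ τ
    c⊆σ∩τ = ⊆-∩⁺ (proj₂ least (σ∈C , p∩q⊆p σ τ)) (proj₂ least (τ∈C , p∩q⊆q σ τ))

proposition33 : ∀ (n : ℕ) (C : Code n) → IsNeuralCode C →
    IntersectionComplete C ⇔ TkBijective C
proposition33 n C _ =
  mk⇔ tk-bijective (surjective⇒intersectionComplete ∘ proj₂)
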